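{- Let $w$ be a permutation (word with distinct letters in $\{1,\ldots,n\}$) containing the pattern $132$. Then there exists a permutation $w'$, greater than $w$ in lexicographic order, such that $w$ and $w'$ are L-adjacent.
   Context: A permutation $w$ contains the pattern $132$ if there are positions $p<q<s$ with $w_p<w_s<w_q$. Two words $u,v$ are L-adjacent if there exist words $w_1,w_2,w_3,w_4$ and letters $a<b<c$ such that $u=w_1\,a\,w_2\,c\,w_3\,b\,w_4$ and $v=w_1\,b\,w_2\,a\,w_3\,c\,w_4$, where all letters of $w_2$ are greater than $b$, and all letters of $w_3$ and $w_4$ are either smaller than $b$ or greater than $c$. -}

module Defs where

open import Data.Nat using (ℕ; _<_; _≤_; _>_)
open import Data.List using (List; []; _∷_; _++_; length; lookup; upTo; map)
open import Data.List.Relation.Unary.All using (All)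
open import Data.List.Relation.Binary.Permutation.Propositional using (_↭_)
open import Data.Fin using (Fin) renaming (_<_ to _<ᶠ_)
open import Data.Product using (Σ; _×_; ∃; ∃-syntax)
open import Data.Sum using (_⊎_)
open import Relation.Binary.PropositionalEquality using (_≡_)

Word : Set
Word = List ℕ

IsPerm : ℕ → Word → Set
IsPerm n w = w ↭ map Data.Nat.suc (upTo n)

Contains132 : Word → Set
Contains132 w =
  ∃[ p ] ∃[ q ] ∃[ s ]
    (p <ᶠ q) × (q <ᶠ s) ×
    (lookup w p < lookup w s) × (lookup w s < lookup w q)

data _<lex_ : Word → Word → Set where
  here  : ∀ {x y u v} → x < y → (x ∷ u) <lex (y ∷ v)
  there : ∀ {x u v} → u <lex v → (x ∷ u) <lex (x ∷ v)
  halt  : ∀ {y v} → [] <lex (y ∷ v)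

LAdjacent : Word → Word → Set
LAdjacent u v =
  ∃[ w₁ ] ∃[ w₂ ] ∃[ w₃ ] ∃[ w₄ ] ∃[ a ] ∃[ b ] ∃[ c ]
    (a < b) × (b < c) ×
    (u ≡ w₁ ++ (a ∷ w₂) ++ (c ∷ w₃) ++ (b ∷ w₄)) ×
    (v ≡ w₁ ++ (b ∷ w₂) ++ (a ∷ w₃) ++ (c ∷ w₄)) ×
    All (λ x → x > b) w₂ ×
    All (λ x → x < b ⊎ x > c) w₃ ×
    All (λ x → x < b ⊎ x > c) w₄

-- Take a 132 occurrence with middle letter c = w_q. Among the letters right of c
-- that lie strictly between w_p and c, let b be the largest; then every other
-- letter right of c is below b or above c. Left of c, let a be the last letter
-- below b; it exists because w_p < b, and every letter between a and c exceeds b.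
-- Rotating a, c, b into b, a, c is then an L-move to a lexicographically larger
-- word (a < b at the first changed position) with the same letters.
module Submission where

open import Defs
open import Data.Nat using (ℕ; _<_; _≤_; _>_; _<?_; s≤s)
open import Data.Nat.Properties using (<-trans; <⇒≤; ≤-trans; ≮⇒≥; <⇒≱; ≤∧≢⇒<; suc-injective)
open import Data.List using (List; []; _∷_; _++_; lookup)
open import Data.List.Properties using (++-assoc)
open import Data.List.Relation.Unary.All as All using (All; []; _∷_)
open import Data.List.Relation.Unary.Any using (here; there)
open import Data.List.Relation.Unary.Unique.Propositional using (Unique; _∷_)
import Data.List.Relation.Unary.Unique.Propositional.Properties as Unique
import Data.List.Relation.Unary.AllPairs as AllPairs
open import Data.List.Relation.Binary.Disjoint.Propositional using (Disjoint)
open import Data.List.Membership.Propositional using (_∈_; _∉_)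
open import Data.List.Membership.Propositional.Properties using (∈-lookup; ∈-++⁺ˡ; ∈-++⁺ʳ)
open import Data.List.Relation.Binary.Permutation.Propositional
  using (_↭_; ↭-sym; ↭-trans; ↭-refl; ↭⇒↭ₛ; prep; swap; module PermutationReasoning)
open import Data.List.Relation.Binary.Permutation.Propositional.Properties using (++⁺ˡ; shift)
import Data.List.Relation.Binary.Permutation.Setoid.Properties as PermutationSetoid
open import Data.Fin using () renaming (zero to fzero; suc to fsuc; _<_ to _<ᶠ_)
open import Data.Product using (∃-syntax; _×_; _,_)
open import Data.Sum using (_⊎_; inj₁; inj₂)
open import Data.Empty using (⊥-elim)
open import Level using (Level; _⊔_)
open import Function using (_∘_)
open import Relation.Nullary using (¬_; yes; no)
open import Relation.Unary using (Pred; Decidable)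
open import Relation.Binary.PropositionalEquality using (_≡_; refl; sym; cong; cong₂; subst; setoid; module ≡-Reasoning)

private
  variable
    ℓ ℓ′ : Level
    A : Set ℓ

IsPerm⇒Unique : ∀ {n w} → IsPerm n w → Unique w
IsPerm⇒Unique {n} w↭ =
  PermutationSetoid.Unique-resp-↭ (setoid ℕ) (↭⇒↭ₛ (↭-sym w↭)) (Unique.map⁺ suc-injective (Unique.upTo⁺ n))

Unique-++⁻ʳ : ∀ (xs : List A) {ys} → Unique (xs ++ ys) → Unique ys
Unique-++⁻ʳ []       u       = u
Unique-++⁻ʳ (x ∷ xs) (_ ∷ u) = Unique-++⁻ʳ xs u

Unique-++⇒Disjoint : ∀ (xs : List A) {ys} → Unique (xs ++ ys) → Disjoint xs ys
Unique-++⇒Disjoint (x ∷ xs) (x∉ ∷ u) (here refl , y∈ys) = All.lookup x∉ (∈-++⁺ʳ xs y∈ys) refl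
Unique-++⇒Disjoint (x ∷ xs) (_  ∷ u) (there y∈xs , y∈ys) = Unique-++⇒Disjoint xs u (y∈xs , y∈ys)

split-at-lookup : ∀ (w : List A) {q s} → q <ᶠ s →
  ∃[ xs ] ∃[ ys ] (w ≡ xs ++ lookup w q ∷ ys × lookup w s ∈ ys)
split-at-lookup (x ∷ w) {fzero}  {fsuc s} _ = [] , w , refl , ∈-lookup s
split-at-lookup (x ∷ w) {fsuc q} {fsuc s} (s≤s q<s) with split-at-lookup w q<s
... | xs , ys , w≡ , s∈ys = x ∷ xs , ys , cong (x ∷_) w≡ , s∈ys

split-between-lookups : ∀ (w : List A) {p q s} → p <ᶠ q → q <ᶠ s →
  ∃[ xs ] ∃[ ys ] (w ≡ xs ++ lookup w q ∷ ys × lookup w p ∈ xs × lookup w s ∈ ys)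
split-between-lookups (x ∷ w) {fzero}  {fsuc q} {fsuc s} _ (s≤s q<s)
  with split-at-lookup w q<s
... | xs , ys , w≡ , s∈ys = x ∷ xs , ys , cong (x ∷_) w≡ , here refl , s∈ys
split-between-lookups (x ∷ w) {fsuc p} {fsuc q} {fsuc s} (s≤s p<q) (s≤s q<s)
  with split-between-lookups w p<q q<s
... | xs , ys , w≡ , p∈xs , s∈ys = x ∷ xs , ys , cong (x ∷_) w≡ , there p∈xs , s∈ys

record LastSatisfying {A : Set ℓ} (P : Pred A ℓ′) (xs : List A) : Set (ℓ ⊔ ℓ′) where
  constructor last
  field
    before : List A
    x      : A
    after  : List A
    split  : xs ≡ before ++ x ∷ after
    holds  : P x
    fails  : All (λ y → ¬ P y) after

lastSatisfying : {P : Pred A ℓ′} → Decidable P → (xs : List A) →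
  All (λ y → ¬ P y) xs ⊎ LastSatisfying P xs
lastSatisfying P? [] = inj₁ []
lastSatisfying P? (x ∷ xs) with lastSatisfying P? xs
... | inj₂ (last ys y zs xs≡ Py ¬Pzs) = inj₂ (last (x ∷ ys) y zs (cong (x ∷_) xs≡) Py ¬Pzs)
... | inj₁ ¬Pxs with P? x
...   | yes Px = inj₂ (last [] x xs refl Px ¬Pxs)
...   | no ¬Px = inj₁ (¬Px ∷ ¬Pxs)

Outside : ℕ → ℕ → ℕ → Set
Outside l u x = x ≤ l ⊎ u ≤ x

Outside-monoˡ : ∀ {l m u x} → l ≤ m → Outside l u x → Outside m u x
Outside-monoˡ l≤m (inj₁ x≤l) = inj₁ (≤-trans x≤l l≤m)
Outside-monoˡ l≤m (inj₂ u≤x) = inj₂ u≤x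

between-or-outside : (l u x : ℕ) → (l < x × x < u) ⊎ Outside l u x
between-or-outside l u x with l <? x | x <? u
... | yes l<x | yes x<u = inj₁ (l<x , x<u)
... | yes _   | no  x≮u = inj₂ (inj₂ (≮⇒≥ x≮u))
... | no  l≮x | _       = inj₂ (inj₁ (≮⇒≥ l≮x))

record LargestBetween (l u : ℕ) (ys : List ℕ) : Set where
  constructor largest
  field
    before : List ℕ
    m      : ℕ
    after  : List ℕ
    split  : ys ≡ before ++ m ∷ after
    l<m    : l < m
    m<u    : m < u
    before-outside : All (Outside m u) before
    after-outside  : All (Outside m u) after

largestBetween : (l u : ℕ) (ys : List ℕ) → All (Outside l u) ys ⊎ LargestBetween l u ys
largestBetween l u [] = inj₁ []
largestBetween l u (y ∷ ys) with between-or-outside l u y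
... | inj₁ (l<y , y<u) with largestBetween y u ys
...   | inj₁ out = inj₂ (largest [] y ys refl l<y y<u [] out)
...   | inj₂ (largest xs m zs ys≡ y<m m<u xs-out zs-out) =
        inj₂ (largest (y ∷ xs) m zs (cong (y ∷_) ys≡) (<-trans l<y y<m) m<u (inj₁ (<⇒≤ y<m) ∷ xs-out) zs-out)
largestBetween l u (y ∷ ys) | inj₂ y-out with largestBetween l u ys
... | inj₁ out = inj₁ (y-out ∷ out)
... | inj₂ (largest xs m zs ys≡ l<m m<u xs-out zs-out) =
      inj₂ (largest (y ∷ xs) m zs (cong (y ∷_) ys≡) l<m m<u (Outside-monoˡ (<⇒≤ l<m) y-out ∷ xs-out) zs-out)

All-≤⇒< : ∀ {b xs} → b ∉ xs → All (b ≤_) xs → All (b <_) xs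
All-≤⇒< b∉xs b≤xs = All.tabulate λ x∈xs → ≤∧≢⇒< (All.lookup b≤xs x∈xs) λ { refl → b∉xs x∈xs }

All-Outside⇒strict : ∀ {b c xs} → b ∉ xs → c ∉ xs → All (Outside b c) xs →
  All (λ x → x < b ⊎ x > c) xs
All-Outside⇒strict {b} {c} {xs} b∉xs c∉xs out = All.tabulate strict
  where
  strict : ∀ {x} → x ∈ xs → x < b ⊎ x > c
  strict x∈xs with All.lookup out x∈xs
  ... | inj₁ x≤b = inj₁ (≤∧≢⇒< x≤b λ { refl → b∉xs x∈xs })
  ... | inj₂ c≤x = inj₂ (≤∧≢⇒< c≤x λ { refl → c∉xs x∈xs })

LAdjacent-rotation : ∀ w₁ a w₂ c w₃ b w₄ → Unique (w₁ ++ a ∷ w₂ ++ c ∷ w₃ ++ b ∷ w₄) →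
  a < b → b < c → All (b ≤_) w₂ → All (Outside b c) w₃ → All (Outside b c) w₄ →
  LAdjacent (w₁ ++ a ∷ w₂ ++ c ∷ w₃ ++ b ∷ w₄) (w₁ ++ b ∷ w₂ ++ a ∷ w₃ ++ c ∷ w₄)
LAdjacent-rotation w₁ a w₂ c w₃ b w₄ u a<b b<c w₂≥b w₃-out w₄-out =
  w₁ , w₂ , w₃ , w₄ , a , b , c , a<b , b<c , refl , refl ,
  All-≤⇒< b∉w₂ w₂≥b ,
  All-Outside⇒strict b∉w₃ (c∉w₃b₄ ∘ ∈-++⁺ˡ) w₃-out ,
  All-Outside⇒strict b∉w₄ (c∉w₃b₄ ∘ ∈-++⁺ʳ w₃ ∘ there) w₄-out
  where
  u₂ : Unique (w₂ ++ c ∷ w₃ ++ b ∷ w₄)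
  u₂ = AllPairs.tail (Unique-++⁻ʳ w₁ u)
  u₃ : Unique (c ∷ w₃ ++ b ∷ w₄)
  u₃ = Unique-++⁻ʳ w₂ u₂
  c∉w₃b₄ : c ∉ w₃ ++ b ∷ w₄
  c∉w₃b₄ = Unique.Unique[x∷xs]⇒x∉xs u₃
  b∉w₂ : b ∉ w₂
  b∉w₂ b∈w₂ = Unique-++⇒Disjoint w₂ u₂ (b∈w₂ , there (∈-++⁺ʳ w₃ (here refl)))
  b∉w₃ : b ∉ w₃
  b∉w₃ b∈w₃ = Unique-++⇒Disjoint w₃ (AllPairs.tail u₃) (b∈w₃ , here refl)
  b∉w₄ : b ∉ w₄
  b∉w₄ = Unique.Unique[x∷xs]⇒x∉xs (Unique-++⁻ʳ w₃ (AllPairs.tail u₃))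

Contains132⇒LAdjacent : ∀ {w} → Unique w → Contains132 w → ∃[ v ] LAdjacent w v
Contains132⇒LAdjacent {w} u (p , q , s , p<q , q<s , wₚ<wₛ , wₛ<c)
  with split-between-lookups w p<q q<s
... | xs , ys , w≡ , wₚ∈xs , wₛ∈ys with largestBetween (lookup w p) (lookup w q) ys
...   | inj₁ ys-out = ⊥-elim (wₛ-between (All.lookup ys-out wₛ∈ys))
  where
  c : ℕ
  c = lookup w q
  wₛ-between : ¬ Outside (lookup w p) c (lookup w s)
  wₛ-between (inj₁ wₛ≤wₚ) = <⇒≱ wₚ<wₛ wₛ≤wₚ
  wₛ-between (inj₂ c≤wₛ)  = <⇒≱ wₛ<c c≤wₛ
...   | inj₂ (largest x₃ b x₄ ys≡ wₚ<b b<c x₃-out x₄-out) with lastSatisfying (_<? b) xs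
...     | inj₁ xs≮b = ⊥-elim (All.lookup xs≮b wₚ∈xs wₚ<b)
...     | inj₂ (last y₁ a y₂ xs≡ a<b y₂≮b) =
  subst (λ w′ → ∃[ v ] LAdjacent w′ v) (sym w≡′)
    (_ , LAdjacent-rotation y₁ a y₂ c x₃ b x₄ (subst Unique w≡′ u) a<b b<c (All.map ≮⇒≥ y₂≮b) x₃-out x₄-out)
  where
  c : ℕ
  c = lookup w q
  w≡′ : w ≡ y₁ ++ a ∷ y₂ ++ c ∷ x₃ ++ b ∷ x₄
  w≡′ = begin
    w                                     ≡⟨ w≡ ⟩
    xs ++ c ∷ ys                          ≡⟨ cong₂ (λ xs ys → xs ++ c ∷ ys) xs≡ ys≡ ⟩
    (y₁ ++ a ∷ y₂) ++ c ∷ x₃ ++ b ∷ x₄    ≡⟨ ++-assoc y₁ (a ∷ y₂) _ ⟩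
    y₁ ++ a ∷ y₂ ++ c ∷ x₃ ++ b ∷ x₄      ∎
    where open ≡-Reasoning

shift₂ : ∀ (v : A) xs ys zs → xs ++ ys ++ v ∷ zs ↭ v ∷ xs ++ ys ++ zs
shift₂ v xs ys zs = ↭-trans (++⁺ˡ xs (shift v ys zs)) (shift v xs (ys ++ zs))

L-cycle-↭ : ∀ (a b c : A) w₂ w₃ w₄ → a ∷ w₂ ++ c ∷ w₃ ++ b ∷ w₄ ↭ b ∷ w₂ ++ a ∷ w₃ ++ c ∷ w₄
L-cycle-↭ a b c w₂ w₃ w₄ = begin
  a ∷ w₂ ++ c ∷ w₃ ++ b ∷ w₄  ↭⟨ prep a (shift c w₂ _) ⟩
  a ∷ c ∷ w₂ ++ w₃ ++ b ∷ w₄  ↭⟨ prep a (prep c (shift₂ b w₂ w₃ w₄)) ⟩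
  a ∷ c ∷ b ∷ w₂ ++ w₃ ++ w₄  ↭⟨ prep a (swap c b ↭-refl) ⟩
  a ∷ b ∷ c ∷ w₂ ++ w₃ ++ w₄  ↭⟨ swap a b ↭-refl ⟩
  b ∷ a ∷ c ∷ w₂ ++ w₃ ++ w₄  ↭⟨ prep b (prep a (shift₂ c w₂ w₃ w₄)) ⟨
  b ∷ a ∷ w₂ ++ w₃ ++ c ∷ w₄  ↭⟨ prep b (shift a w₂ _) ⟨
  b ∷ w₂ ++ a ∷ w₃ ++ c ∷ w₄  ∎
  where open PermutationReasoning

LAdjacent⇒↭ : ∀ {u v} → LAdjacent u v → u ↭ v
LAdjacent⇒↭ (w₁ , w₂ , w₃ , w₄ , a , b , c , _ , _ , refl , refl , _) = ++⁺ˡ w₁ (L-cycle-↭ a b c w₂ w₃ w₄)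

++-<lex : ∀ w {x y u v} → x < y → (w ++ x ∷ u) <lex (w ++ y ∷ v)
++-<lex []      x<y = here x<y
++-<lex (_ ∷ w) x<y = there (++-<lex w x<y)

LAdjacent⇒<lex : ∀ {u v} → LAdjacent u v → u <lex v
LAdjacent⇒<lex (w₁ , _ , _ , _ , _ , _ , _ , a<b , _ , refl , refl , _) = ++-<lex w₁ a<b

mainTheorem17 : (n : ℕ) (w : Word) → IsPerm n w → Contains132 w →
    ∃[ w′ ] (IsPerm n w′ × w <lex w′ × LAdjacent w w′)
mainTheorem17 n w w-perm w-132 =
  let w′ , adj = Contains132⇒LAdjacent (IsPerm⇒Unique w-perm) w-132
  in w′ , ↭-trans (↭-sym (LAdjacent⇒↭ adj)) w-perm , LAdjacent⇒<lex adj , adj
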